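{- Let $G$ be a matroid on $[n]$ with no loops and no multiple points. Suppose that for every circuit $S$ of $G$ with $|S|\ge 4$ there are two disjoint two-element subsets $\{a,b\},\{c,d\}\subseteq S$ such that $\operatorname{cl}(\{a,b\})\cap\operatorname{cl}(\{c,d\})\neq\emptyset$. Then $G$ is line-closed.
   Context: $\operatorname{cl}$ denotes matroid closure. A subset $S\subseteq[n]$ is line-closed if $\operatorname{cl}(\{i,j\})\subseteq S$ for all $i,j\in S$; $G$ is line-closed if every line-closed set is closed. -}

module Defs where

open import Data.Nat using (ℕ; _+_; _≤_)
open import Data.Fin using (Fin)
open import Data.Fin.Subset using (Subset; _∈_; _⊆_; _⊂_; _∪_; _∩_; ⁅_⁆; ∣_∣)
open import Data.Product using (_×_; ∃-syntax)
open import Relation.Binary.PropositionalEquality using (_≡_; _≢_)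
open import Relation.Nullary using (¬_)

record Matroid (n : ℕ) : Set where
  field
    rank      : Subset n → ℕ
    rank-≤    : ∀ A → rank A ≤ ∣ A ∣
    rank-mono : ∀ {A B} → A ⊆ B → rank A ≤ rank B
    rank-sub  : ∀ A B → rank (A ∪ B) + rank (A ∩ B) ≤ rank A + rank B

module _ {n : ℕ} (G : Matroid n) where
  open Matroid G

  Independent : Subset n → Set
  Independent A = rank A ≡ ∣ A ∣

  Circuit : Subset n → Set
  Circuit S = ¬ Independent S × (∀ T → T ⊂ S → Independent T)

  _∈cl_ : Fin n → Subset n → Set
  x ∈cl A = rank (A ∪ ⁅ x ⁆) ≡ rank A

  Closed : Subset n → Set
  Closed S = ∀ x → x ∈cl S → x ∈ S

  LineClosedSet : Subset n → Set
  LineClosedSet S = ∀ i j → i ∈ S → j ∈ S → ∀ x → x ∈cl (⁅ i ⁆ ∪ ⁅ j ⁆) → x ∈ S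

  LineClosed : Set
  LineClosed = ∀ S → LineClosedSet S → Closed S

  NoLoops : Set
  NoLoops = ∀ i → Independent ⁅ i ⁆

  NoMultiplePoints : Set
  NoMultiplePoints = ∀ i j → i ≢ j → Independent (⁅ i ⁆ ∪ ⁅ j ⁆)

{-# OPTIONS --safe #-}
module Submission where

-- Let S be line-closed and x ∈ cl(T) for some T ⊆ S; induct on |T|. If |T| ≤ 2, x ∈ S by
-- line-closedness, and if x ∈ cl(T - t) for some t ∈ T, replace T by T - t. Otherwise T is
-- independent and T ∪ {x} is a circuit with at least four elements, so it contains disjoint
-- pairs {a,b} and {c,d} whose lines meet in some y, and y ∈ S. If x is one of them, say x = a, the
-- exchange property gives x ∈ cl{b,y} ⊆ S. If not, it gives a ∈ cl{b,y} and c ∈ cl{d,y},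
-- so the smaller set (T - a - c) ∪ {y} ⊆ S still spans x.

open import Defs
open import Algebra using (CommutativeMonoid)
open import Data.Bool using (true; false)
open import Data.Empty using (⊥-elim)
open import Data.Fin using (Fin; zero; suc; _≟_)
open import Data.Fin.Properties using (any?)
open import Data.Fin.Subset
  using (Subset; _∈_; _∉_; _⊆_; _⊂_; _∪_; _∩_; _─_; _-_; ⁅_⁆; ∣_∣)
  renaming (⊥ to ∅)
open import Data.Fin.Subset.Induction using (⊂-wellFounded)
open import Data.Fin.Subset.Properties
open import Data.Nat using (ℕ; suc; _+_; _≤_; _<_; z≤n; s≤s; _≤?_)
open import Data.Nat.Induction using (<-wellFounded)
open import Data.Nat.Properties
  using (≤-reflexive; ≤-trans; ≤-antisym; ≤∧≢⇒<; <⇒≱; ≰⇒>; 1+n≰n; m≤n⇒m≤1+n;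
         m≤m+n; +-comm; +-suc; +-mono-≤; +-monoˡ-≤; +-monoʳ-≤; +-cancelˡ-≤; +-cancelʳ-≤;
         module ≤-Reasoning)
  renaming (_≟_ to _≟ℕ_)
open import Data.Product using (_×_; _,_; ∃-syntax)
open import Data.Sum using (_⊎_; inj₁; inj₂)
open import Data.Vec using (_∷_; []; here; there)
open import Function using (_∘_)
open import Induction.WellFounded using (Acc; acc)
open import Relation.Binary.PropositionalEquality
  using (_≡_; _≢_; refl; sym; trans; cong; subst; ≢-sym; module ≡-Reasoning)
open import Relation.Nullary using (¬_; Dec; yes; no)
open import Relation.Nullary.Decidable using (_×-dec_)

private
  variable
    k : ℕ
    p q r : Subset k
    x y z : Fin k

∪-lub : p ⊆ r → q ⊆ r → p ∪ q ⊆ r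
∪-lub {p = p} {q = q} p⊆r q⊆r x∈p∪q with x∈p∪q⁻ p q x∈p∪q
... | inj₁ x∈p = p⊆r x∈p
... | inj₂ x∈q = q⊆r x∈q

∪-monoˡ-⊆ : p ⊆ q → p ∪ r ⊆ q ∪ r
∪-monoˡ-⊆ p⊆q = ∪-lub (x∈p∪q⁺ ∘ inj₁ ∘ p⊆q) (x∈p∪q⁺ ∘ inj₂)

x∈p⇒⁅x⁆⊆p : x ∈ p → ⁅ x ⁆ ⊆ p
x∈p⇒⁅x⁆⊆p {x = x} {p = p} x∈p y∈⁅x⁆ = subst (_∈ p) (sym (x∈⁅y⁆⇒x≡y x y∈⁅x⁆)) x∈p

x∈p∪⁅y⁆∧x≢y⇒x∈p : x ∈ p ∪ ⁅ y ⁆ → x ≢ y → x ∈ p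
x∈p∪⁅y⁆∧x≢y⇒x∈p {p = p} {y = y} x∈p∪⁅y⁆ x≢y with x∈p∪q⁻ p ⁅ y ⁆ x∈p∪⁅y⁆
... | inj₁ x∈p   = x∈p
... | inj₂ x∈⁅y⁆ = ⊥-elim (x≢y (x∈⁅y⁆⇒x≡y y x∈⁅y⁆))

x∉⁅y⁆∪⁅z⁆ : x ≢ y → x ≢ z → x ∉ ⁅ y ⁆ ∪ ⁅ z ⁆
x∉⁅y⁆∪⁅z⁆ x≢y x≢z x∈ = x≢y (x∈⁅y⁆⇒x≡y _ (x∈p∪⁅y⁆∧x≢y⇒x∈p x∈ x≢z))

p-x⊆p : p - x ⊆ p
p-x⊆p {p = p} {x = x} = p─q⊆p p ⁅ x ⁆

x∉p-x : ∀ (p : Subset k) x → x ∉ p - x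
x∉p-x (_ ∷ p) zero    ()
x∉p-x (_ ∷ p) (suc x) (there x∈p-x) = x∉p-x p x x∈p-x

x∈p-y⇒x≢y : x ∈ p - y → x ≢ y
x∈p-y⇒x≢y {p = p} x∈p-x refl = x∉p-x p _ x∈p-x

p⊆[p─q]∪q : ∀ (p q : Subset k) → p ⊆ (p ─ q) ∪ q
p⊆[p─q]∪q p q {x} x∈p with x ∈? q
... | yes x∈q = x∈p∪q⁺ (inj₂ x∈q)
... | no  x∉q = x∈p∪q⁺ (inj₁ (x∈p∧x∉q⇒x∈p─q x∈p x∉q))

∣p─q∣+∣q∣≡∣p∣ : ∀ (p q : Subset k) → q ⊆ p → ∣ p ─ q ∣ + ∣ q ∣ ≡ ∣ p ∣
∣p─q∣+∣q∣≡∣p∣ []          []          _   = refl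
∣p─q∣+∣q∣≡∣p∣ (true ∷ p)  (true ∷ q)  q⊆p =
  trans (+-suc ∣ p ─ q ∣ ∣ q ∣) (cong suc (∣p─q∣+∣q∣≡∣p∣ p q (drop-∷-⊆ q⊆p)))
∣p─q∣+∣q∣≡∣p∣ (true ∷ p)  (false ∷ q) q⊆p = cong suc (∣p─q∣+∣q∣≡∣p∣ p q (drop-∷-⊆ q⊆p))
∣p─q∣+∣q∣≡∣p∣ (false ∷ p) (true ∷ q)  q⊆p with q⊆p here
... | ()
∣p─q∣+∣q∣≡∣p∣ (false ∷ p) (false ∷ q) q⊆p = ∣p─q∣+∣q∣≡∣p∣ p q (drop-∷-⊆ q⊆p)

x∈p⇒1+∣p-x∣≡∣p∣ : x ∈ p → suc ∣ p - x ∣ ≡ ∣ p ∣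
x∈p⇒1+∣p-x∣≡∣p∣ {x = x} {p = p} x∈p = begin
  suc ∣ p - x ∣         ≡⟨ +-comm 1 ∣ p - x ∣ ⟩
  ∣ p - x ∣ + 1         ≡⟨ cong (∣ p - x ∣ +_) (sym (∣⁅x⁆∣≡1 x)) ⟩
  ∣ p - x ∣ + ∣ ⁅ x ⁆ ∣ ≡⟨ ∣p─q∣+∣q∣≡∣p∣ p ⁅ x ⁆ (x∈p⇒⁅x⁆⊆p x∈p) ⟩
  ∣ p ∣                 ∎
  where open ≡-Reasoning

x∉p⇒∣p∪⁅x⁆∣≡1+∣p∣ : ∀ (p : Subset k) x → x ∉ p → ∣ p ∪ ⁅ x ⁆ ∣ ≡ suc ∣ p ∣
x∉p⇒∣p∪⁅x⁆∣≡1+∣p∣ (true ∷ p)  zero    x∉p = ⊥-elim (x∉p here)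
x∉p⇒∣p∪⁅x⁆∣≡1+∣p∣ (false ∷ p) zero    x∉p = cong (suc ∘ ∣_∣) (∪-identityʳ p)
x∉p⇒∣p∪⁅x⁆∣≡1+∣p∣ (true ∷ p)  (suc x) x∉p = cong suc (x∉p⇒∣p∪⁅x⁆∣≡1+∣p∣ p x (x∉p ∘ there))
x∉p⇒∣p∪⁅x⁆∣≡1+∣p∣ (false ∷ p) (suc x) x∉p = x∉p⇒∣p∪⁅x⁆∣≡1+∣p∣ p x (x∉p ∘ there)

∣p∪⁅x⁆∣≤1+∣p∣ : ∀ (p : Subset k) x → ∣ p ∪ ⁅ x ⁆ ∣ ≤ suc ∣ p ∣
∣p∪⁅x⁆∣≤1+∣p∣ p x with x ∈? p
... | yes x∈p = m≤n⇒m≤1+n (p⊆q⇒∣p∣≤∣q∣ (∪-lub (λ y∈p → y∈p) (x∈p⇒⁅x⁆⊆p x∈p)))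
... | no  x∉p = ≤-reflexive (x∉p⇒∣p∪⁅x⁆∣≡1+∣p∣ p x x∉p)

∣p∣≤2⇒p⊆⁅x⁆∪⁅y⁆ : x ∈ p → ∣ p ∣ ≤ 2 → ∃[ y ] (y ∈ p × p ⊆ ⁅ x ⁆ ∪ ⁅ y ⁆)
∣p∣≤2⇒p⊆⁅x⁆∪⁅y⁆ {x = x} {p = p} x∈p ∣p∣≤2 with nonempty? (p - x)
... | no p-x-empty = x , x∈p , p⊆⁅x⁆∪⁅x⁆
  where
  p⊆⁅x⁆∪⁅x⁆ : p ⊆ ⁅ x ⁆ ∪ ⁅ x ⁆
  p⊆⁅x⁆∪⁅x⁆ {z} z∈p with z ≟ x
  ... | yes refl = x∈p∪q⁺ (inj₁ (x∈⁅x⁆ x))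
  ... | no  z≢x  = ⊥-elim (p-x-empty (z , x∈p∧x≢y⇒x∈p-y z∈p z≢x))
... | yes (y , y∈p-x) = y , p-x⊆p y∈p-x , p⊆⁅x⁆∪⁅y⁆
  where
  p⊆⁅x⁆∪⁅y⁆ : p ⊆ ⁅ x ⁆ ∪ ⁅ y ⁆
  p⊆⁅x⁆∪⁅y⁆ {z} z∈p with z ≟ x | z ≟ y
  ... | yes refl | _        = x∈p∪q⁺ (inj₁ (x∈⁅x⁆ x))
  ... | no  _    | yes refl = x∈p∪q⁺ (inj₂ (x∈⁅x⁆ y))
  ... | no  z≢x  | no  z≢y  = ⊥-elim (<⇒≱ 2<∣p∣ ∣p∣≤2)
    where
    open ≤-Reasoning
    z∈p-x-y : z ∈ p - x - y
    z∈p-x-y = x∈p∧x≢y⇒x∈p-y (x∈p∧x≢y⇒x∈p-y z∈p z≢x) z≢y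
    2<∣p∣ : 2 < ∣ p ∣
    2<∣p∣ = begin
      3                     ≤⟨ s≤s (s≤s (s≤s z≤n)) ⟩
      3 + ∣ p - x - y - z ∣ ≤⟨ s≤s (s≤s (x∈p⇒∣p-x∣<∣p∣ z∈p-x-y)) ⟩
      2 + ∣ p - x - y ∣     ≤⟨ s≤s (x∈p⇒∣p-x∣<∣p∣ y∈p-x) ⟩
      1 + ∣ p - x ∣         ≤⟨ x∈p⇒∣p-x∣<∣p∣ x∈p ⟩
      ∣ p ∣                 ∎

module _ {n : ℕ} (G : Matroid n) where
  open Matroid G
  open import Algebra.Properties.CommutativeSemigroup
    (CommutativeMonoid.commutativeSemigroup (∪-commutativeMonoid n)) using (xy∙z≈xz∙y)

  rank-subadditive : ∀ A B → rank (A ∪ B) ≤ rank A + rank B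
  rank-subadditive A B = ≤-trans (m≤m+n _ _) (rank-sub A B)

  rank-∪⁅x⁆≤1+rank : ∀ A x → rank (A ∪ ⁅ x ⁆) ≤ suc (rank A)
  rank-∪⁅x⁆≤1+rank A x = begin
    rank (A ∪ ⁅ x ⁆)      ≤⟨ rank-subadditive A ⁅ x ⁆ ⟩
    rank A + rank ⁅ x ⁆   ≤⟨ +-monoʳ-≤ (rank A) (rank-≤ ⁅ x ⁆) ⟩
    rank A + ∣ ⁅ x ⁆ ∣    ≡⟨ cong (rank A +_) (∣⁅x⁆∣≡1 x) ⟩
    rank A + 1            ≡⟨ +-comm (rank A) 1 ⟩
    suc (rank A)          ∎
    where open ≤-Reasoning

  rank-diminishing-returns : ∀ {A B} z → A ⊆ B →
                             rank (B ∪ ⁅ z ⁆) + rank A ≤ rank (A ∪ ⁅ z ⁆) + rank B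
  rank-diminishing-returns {A} {B} z A⊆B = begin
    rank (B ∪ ⁅ z ⁆) + rank A
      ≤⟨ +-mono-≤ (rank-mono (∪-lub (p⊆p∪q _) (q⊆p∪q B _ ∘ q⊆p∪q A ⁅ z ⁆)))
                  (rank-mono (λ x∈A → x∈p∩q⁺ (A⊆B x∈A , p⊆p∪q ⁅ z ⁆ x∈A))) ⟩
    rank (B ∪ (A ∪ ⁅ z ⁆)) + rank (B ∩ (A ∪ ⁅ z ⁆))
      ≤⟨ rank-sub B (A ∪ ⁅ z ⁆) ⟩
    rank B + rank (A ∪ ⁅ z ⁆)
      ≡⟨ +-comm (rank B) _ ⟩
    rank (A ∪ ⁅ z ⁆) + rank B ∎
    where open ≤-Reasoning

  ∈cl-mono : ∀ {x A B} → A ⊆ B → _∈cl_ G x A → _∈cl_ G x B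
  ∈cl-mono {x} {A} {B} A⊆B x∈clA = ≤-antisym rank-B∪x≤rank-B (rank-mono (p⊆p∪q ⁅ x ⁆))
    where
    rank-B∪x≤rank-B : rank (B ∪ ⁅ x ⁆) ≤ rank B
    rank-B∪x≤rank-B = +-cancelʳ-≤ (rank A) _ _ (begin
      rank (B ∪ ⁅ x ⁆) + rank A ≤⟨ rank-diminishing-returns x A⊆B ⟩
      rank (A ∪ ⁅ x ⁆) + rank B ≡⟨ cong (_+ rank B) x∈clA ⟩
      rank A + rank B           ≡⟨ +-comm (rank A) (rank B) ⟩
      rank B + rank A           ∎)
      where open ≤-Reasoning

  ∈cl-trans : ∀ {x y A} → _∈cl_ G y A → _∈cl_ G x (A ∪ ⁅ y ⁆) → _∈cl_ G x A
  ∈cl-trans {x} {y} {A} y∈clA x∈clA∪y = ≤-antisym (begin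
    rank (A ∪ ⁅ x ⁆)            ≤⟨ rank-mono (∪-monoˡ-⊆ (p⊆p∪q ⁅ y ⁆)) ⟩
    rank ((A ∪ ⁅ y ⁆) ∪ ⁅ x ⁆)  ≡⟨ x∈clA∪y ⟩
    rank (A ∪ ⁅ y ⁆)            ≡⟨ y∈clA ⟩
    rank A                      ∎) (rank-mono (p⊆p∪q ⁅ x ⁆))
    where open ≤-Reasoning

  ∈cl-exchange : ∀ {x y A} → ¬ _∈cl_ G y A → _∈cl_ G y (A ∪ ⁅ x ⁆) → _∈cl_ G x (A ∪ ⁅ y ⁆)
  ∈cl-exchange {x} {y} {A} y∉clA y∈clA∪x = ≤-antisym (begin
    rank ((A ∪ ⁅ y ⁆) ∪ ⁅ x ⁆)  ≡⟨ cong rank (xy∙z≈xz∙y A ⁅ y ⁆ ⁅ x ⁆) ⟩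
    rank ((A ∪ ⁅ x ⁆) ∪ ⁅ y ⁆)  ≡⟨ y∈clA∪x ⟩
    rank (A ∪ ⁅ x ⁆)            ≤⟨ rank-∪⁅x⁆≤1+rank A x ⟩
    suc (rank A)                ≤⟨ ≤∧≢⇒< (rank-mono (p⊆p∪q ⁅ y ⁆)) (y∉clA ∘ sym) ⟩
    rank (A ∪ ⁅ y ⁆)            ∎) (rank-mono (p⊆p∪q ⁅ x ⁆))
    where open ≤-Reasoning

  independent-⊆ : ∀ {A B} → A ⊆ B → Independent G B → Independent G A
  independent-⊆ {A} {B} A⊆B B-ind = ≤-antisym (rank-≤ A) (+-cancelˡ-≤ ∣ B ─ A ∣ _ _ (begin
    ∣ B ─ A ∣ + ∣ A ∣        ≡⟨ ∣p─q∣+∣q∣≡∣p∣ B A A⊆B ⟩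
    ∣ B ∣                    ≡⟨ sym B-ind ⟩
    rank B                   ≤⟨ rank-mono (p⊆[p─q]∪q B A) ⟩
    rank ((B ─ A) ∪ A)       ≤⟨ rank-subadditive (B ─ A) A ⟩
    rank (B ─ A) + rank A    ≤⟨ +-monoˡ-≤ (rank A) (rank-≤ (B ─ A)) ⟩
    ∣ B ─ A ∣ + rank A       ∎))
    where open ≤-Reasoning

  independent-∪⁅x⁆ : ∀ {x A} → Independent G A → x ∉ A → ¬ _∈cl_ G x A →
                     Independent G (A ∪ ⁅ x ⁆)
  independent-∪⁅x⁆ {x} {A} A-ind x∉A x∉clA = ≤-antisym (rank-≤ _) (begin
    ∣ A ∪ ⁅ x ⁆ ∣     ≡⟨ x∉p⇒∣p∪⁅x⁆∣≡1+∣p∣ A x x∉A ⟩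
    suc ∣ A ∣         ≡⟨ cong suc (sym A-ind) ⟩
    suc (rank A)      ≤⟨ ≤∧≢⇒< (rank-mono (p⊆p∪q ⁅ x ⁆)) (x∉clA ∘ sym) ⟩
    rank (A ∪ ⁅ x ⁆)  ∎)
    where open ≤-Reasoning

  independent⇒∉cl : ∀ {x A} → Independent G (A ∪ ⁅ x ⁆) → x ∉ A → ¬ _∈cl_ G x A
  independent⇒∉cl {x} {A} A∪x-ind x∉A x∈clA = 1+n≰n (begin
    suc ∣ A ∣         ≡⟨ sym (x∉p⇒∣p∪⁅x⁆∣≡1+∣p∣ A x x∉A) ⟩
    ∣ A ∪ ⁅ x ⁆ ∣     ≡⟨ sym A∪x-ind ⟩
    rank (A ∪ ⁅ x ⁆)  ≡⟨ x∈clA ⟩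
    rank A            ≤⟨ rank-≤ A ⟩
    ∣ A ∣             ∎)
    where open ≤-Reasoning

  independent⇒∉cl-pair : ∀ {x y z T} → Independent G T → x ∈ T → y ∈ T → z ∈ T →
                         x ≢ y → x ≢ z → ¬ _∈cl_ G x (⁅ y ⁆ ∪ ⁅ z ⁆)
  independent⇒∉cl-pair {x} {y} {z} {T} T-ind x∈T y∈T z∈T x≢y x≢z =
    independent⇒∉cl (independent-⊆ yzx⊆T T-ind) (x∉⁅y⁆∪⁅z⁆ x≢y x≢z)
    where
    yzx⊆T : (⁅ y ⁆ ∪ ⁅ z ⁆) ∪ ⁅ x ⁆ ⊆ T
    yzx⊆T = ∪-lub (∪-lub (x∈p⇒⁅x⁆⊆p y∈T) (x∈p⇒⁅x⁆⊆p z∈T)) (x∈p⇒⁅x⁆⊆p x∈T)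

  Coloop : Subset n → Fin n → Set
  Coloop T s = rank (T - s) < rank T

  coloop-deletion : ∀ {T s t} → s ∈ T - t → Coloop T s → Coloop (T - t) s
  coloop-deletion {T} {s} {t} s∈T-t drop =
    +-cancelʳ-≤ (rank (T - s)) _ _ (begin
      suc (rank (T - t - s)) + rank (T - s)    ≡⟨ sym (+-suc (rank (T - t - s)) _) ⟩
      rank (T - t - s) + suc (rank (T - s))    ≤⟨ +-monoʳ-≤ (rank (T - t - s)) drop ⟩
      rank (T - t - s) + rank T                ≡⟨ +-comm (rank (T - t - s)) _ ⟩
      rank T + rank (T - t - s)
        ≤⟨ +-monoˡ-≤ _ (rank-mono (p⊆[p─q]∪q T ⁅ s ⁆)) ⟩
      rank ((T - s) ∪ ⁅ s ⁆) + rank (T - t - s)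
        ≤⟨ rank-diminishing-returns s T-t-s⊆T-s ⟩
      rank ((T - t - s) ∪ ⁅ s ⁆) + rank (T - s)
        ≤⟨ +-monoˡ-≤ _ (rank-mono (∪-lub (p-x⊆p {x = s}) (x∈p⇒⁅x⁆⊆p s∈T-t))) ⟩
      rank (T - t) + rank (T - s)              ∎)
    where
    open ≤-Reasoning
    T-t-s⊆T-s : T - t - s ⊆ T - s
    T-t-s⊆T-s x∈ = x∈p∧x≢y⇒x∈p-y (p-x⊆p (p-x⊆p x∈)) (x∈p-y⇒x≢y x∈)

  all-coloops⇒independent : ∀ T → (∀ t → t ∈ T → Coloop T t) → Independent G T
  all-coloops⇒independent T = go T (⊂-wellFounded T)
    where
    go : ∀ T → Acc _⊂_ T → (∀ t → t ∈ T → Coloop T t) → Independent G T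
    go T (acc rec) coloops with nonempty? T
    ... | no T-empty = ≤-antisym (rank-≤ T)
                         (≤-trans (≤-reflexive (trans (cong ∣_∣ (Empty-unique T-empty)) (∣⊥∣≡0 n))) z≤n)
    ... | yes (t , t∈T) = ≤-antisym (rank-≤ T) (begin
      ∣ T ∣               ≡⟨ sym (x∈p⇒1+∣p-x∣≡∣p∣ t∈T) ⟩
      suc ∣ T - t ∣       ≡⟨ cong suc (sym T-t-ind) ⟩
      suc (rank (T - t))  ≤⟨ coloops t t∈T ⟩
      rank T              ∎)
      where
      open ≤-Reasoning
      T-t-ind : Independent G (T - t)
      T-t-ind = go (T - t) (rec (x∈p⇒p-x⊂p t∈T))
                  (λ s s∈T-t → coloop-deletion s∈T-t (coloops s (p-x⊆p s∈T-t)))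

  minimal-span⇒independent : ∀ {x T} → _∈cl_ G x T → (∀ t → t ∈ T → ¬ _∈cl_ G x (T - t)) →
                             Independent G T
  minimal-span⇒independent {x} {T} x∈clT minimal = all-coloops⇒independent T coloop
    where
    coloop : ∀ t → t ∈ T → Coloop T t
    coloop t t∈T = begin-strict
      rank (T - t)            <⟨ ≤∧≢⇒< (rank-mono (p⊆p∪q ⁅ x ⁆)) (minimal t t∈T ∘ sym) ⟩
      rank ((T - t) ∪ ⁅ x ⁆)  ≤⟨ rank-mono (∪-monoˡ-⊆ p-x⊆p) ⟩
      rank (T ∪ ⁅ x ⁆)        ≡⟨ x∈clT ⟩
      rank T                  ∎
      where open ≤-Reasoning

  minimal-span⇒circuit : ∀ {x T} → x ∉ T → _∈cl_ G x T → (∀ t → t ∈ T → ¬ _∈cl_ G x (T - t)) →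
                         Circuit G (T ∪ ⁅ x ⁆)
  minimal-span⇒circuit {x} {T} x∉T x∈clT minimal = dependent , proper⇒independent
    where
    T-ind : Independent G T
    T-ind = minimal-span⇒independent x∈clT minimal
    dependent : ¬ Independent G (T ∪ ⁅ x ⁆)
    dependent T∪x-ind = independent⇒∉cl T∪x-ind x∉T x∈clT
    proper⇒independent : ∀ P → P ⊂ T ∪ ⁅ x ⁆ → Independent G P
    proper⇒independent P (P⊆T∪x , c , c∈T∪x , c∉P) with c ≟ x
    ... | yes refl = independent-⊆ P⊆T T-ind
      where
      P⊆T : P ⊆ T
      P⊆T z∈P = x∈p∪⁅y⁆∧x≢y⇒x∈p (P⊆T∪x z∈P) (λ { refl → c∉P z∈P })
    ... | no c≢x = independent-⊆ P⊆T-c∪x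
                     (independent-∪⁅x⁆ (independent-⊆ p-x⊆p T-ind) (x∉T ∘ p-x⊆p)
                                       (minimal c (x∈p∪⁅y⁆∧x≢y⇒x∈p c∈T∪x c≢x)))
      where
      P⊆T-c∪x : P ⊆ (T - c) ∪ ⁅ x ⁆
      P⊆T-c∪x z∈P with x∈p∪q⁻ T ⁅ x ⁆ (P⊆T∪x z∈P)
      ... | inj₁ z∈T = x∈p∪q⁺ (inj₁ (x∈p∧x≢y⇒x∈p-y z∈T (λ { refl → c∉P z∈P })))
      ... | inj₂ z∈x = x∈p∪q⁺ (inj₂ z∈x)

  loopless⇒∉cl∅ : NoLoops G → ∀ x → ¬ _∈cl_ G x ∅
  loopless⇒∉cl∅ loopless x = independent⇒∉cl x-ind ∉⊥
    where
    x-ind : Independent G (∅ ∪ ⁅ x ⁆)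
    x-ind = subst (Independent G) (sym (∪-identityˡ ⁅ x ⁆)) (loopless x)

  simple⇒∉cl⁅y⁆ : NoMultiplePoints G → ∀ {x y} → x ≢ y → ¬ _∈cl_ G x ⁅ y ⁆
  simple⇒∉cl⁅y⁆ simple {x} {y} x≢y = independent⇒∉cl (simple y x (≢-sym x≢y)) (x≢y⇒x∉⁅y⁆ x≢y)

  meeting-lines-span : NoMultiplePoints G → ∀ {a b c d y x T} → y ≢ b → y ≢ d →
    b ∈ T - a - c → d ∈ T - a - c → _∈cl_ G y (⁅ a ⁆ ∪ ⁅ b ⁆) → _∈cl_ G y (⁅ c ⁆ ∪ ⁅ d ⁆) →
    _∈cl_ G x T → _∈cl_ G x ((T - a - c) ∪ ⁅ y ⁆)
  meeting-lines-span simple {a} {b} {c} {d} {y} {x} {T} y≢b y≢d b∈T' d∈T' y∈ab y∈cd x∈clT =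
    ∈cl-trans a∈clT' (∈cl-trans c∈clT'∪a (∈cl-mono T⊆T'∪a∪c x∈clT))
    where
    T' : Subset n
    T' = (T - a - c) ∪ ⁅ y ⁆
    y∈T' : y ∈ T'
    y∈T' = x∈p∪q⁺ (inj₂ (x∈⁅x⁆ y))
    a∈clT' : _∈cl_ G a T'
    a∈clT' = ∈cl-mono (∪-lub (x∈p⇒⁅x⁆⊆p (x∈p∪q⁺ (inj₁ b∈T'))) (x∈p⇒⁅x⁆⊆p y∈T'))
               (∈cl-exchange (simple⇒∉cl⁅y⁆ simple y≢b) (subst (_∈cl_ G y) (∪-comm ⁅ a ⁆ ⁅ b ⁆) y∈ab))
    c∈clT'∪a : _∈cl_ G c (T' ∪ ⁅ a ⁆)
    c∈clT'∪a = ∈cl-mono (∪-lub (x∈p⇒⁅x⁆⊆p (x∈p∪q⁺ (inj₁ (x∈p∪q⁺ (inj₁ d∈T')))))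
                               (x∈p⇒⁅x⁆⊆p (x∈p∪q⁺ (inj₁ y∈T'))))
               (∈cl-exchange (simple⇒∉cl⁅y⁆ simple y≢d) (subst (_∈cl_ G y) (∪-comm ⁅ c ⁆ ⁅ d ⁆) y∈cd))
    T⊆T'∪a∪c : T ⊆ (T' ∪ ⁅ a ⁆) ∪ ⁅ c ⁆
    T⊆T'∪a∪c {z} z∈T with z ≟ a | z ≟ c
    ... | yes refl | _        = x∈p∪q⁺ (inj₁ (x∈p∪q⁺ (inj₂ (x∈⁅x⁆ a))))
    ... | no  _    | yes refl = x∈p∪q⁺ (inj₂ (x∈⁅x⁆ c))
    ... | no  z≢a  | no  z≢c  =
      x∈p∪q⁺ (inj₁ (x∈p∪q⁺ (inj₁ (x∈p∪q⁺ (inj₁ (x∈p∧x≢y⇒x∈p-y (x∈p∧x≢y⇒x∈p-y z∈T z≢a) z≢c))))))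

  _∈cl?_ : ∀ x A → Dec (_∈cl_ G x A)
  x ∈cl? A = rank (A ∪ ⁅ x ⁆) ≟ℕ rank A

  MeetingLines : Subset n → Set
  MeetingLines C = ∃[ a ] ∃[ b ] ∃[ c ] ∃[ d ]
    (a ∈ C × b ∈ C × c ∈ C × d ∈ C
     × a ≢ b × c ≢ d × a ≢ c × a ≢ d × b ≢ c × b ≢ d
     × ∃[ y ] (_∈cl_ G y (⁅ a ⁆ ∪ ⁅ b ⁆) × _∈cl_ G y (⁅ c ⁆ ∪ ⁅ d ⁆)))

  module _ (loopless : NoLoops G) (simple : NoMultiplePoints G)
           (S : Subset n) (S-lc : LineClosedSet G S) where

    small-set-closure : ∀ {x T} → T ⊆ S → ∣ T ∣ ≤ 2 → _∈cl_ G x T → x ∈ S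
    small-set-closure {x} {T} T⊆S ∣T∣≤2 x∈clT with nonempty? T
    ... | no T-empty =
      ⊥-elim (loopless⇒∉cl∅ loopless x (subst (_∈cl_ G x) (Empty-unique T-empty) x∈clT))
    ... | yes (i , i∈T) with ∣p∣≤2⇒p⊆⁅x⁆∪⁅y⁆ i∈T ∣T∣≤2
    ... | j , j∈T , T⊆ij = S-lc i j (T⊆S i∈T) (T⊆S j∈T) x (∈cl-mono T⊆ij x∈clT)

    meeting-line-through : ∀ {q r s y x} → y ≢ q → q ∈ S → r ∈ S → s ∈ S →
      _∈cl_ G y (⁅ q ⁆ ∪ ⁅ x ⁆) → _∈cl_ G y (⁅ r ⁆ ∪ ⁅ s ⁆) → x ∈ S
    meeting-line-through {q} {r} {s} {y} {x} y≢q q∈S r∈S s∈S y∈qx y∈rs =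
      S-lc q y q∈S y∈S x (∈cl-exchange (simple⇒∉cl⁅y⁆ simple y≢q) y∈qx)
      where
      y∈S : y ∈ S
      y∈S = S-lc r s r∈S s∈S y y∈rs

    module _ {x : Fin n} {T : Subset n} (T⊆S : T ⊆ S) (T-ind : Independent G T) where

      meeting-line-through-x : ∀ {q r s y} → q ∈ T → r ∈ T → s ∈ T → q ≢ r → q ≢ s →
        _∈cl_ G y (⁅ q ⁆ ∪ ⁅ x ⁆) → _∈cl_ G y (⁅ r ⁆ ∪ ⁅ s ⁆) → x ∈ S
      meeting-line-through-x {q} {r} {s} {y} q∈T r∈T s∈T q≢r q≢s y∈qx y∈rs =
        meeting-line-through y≢q (T⊆S q∈T) (T⊆S r∈T) (T⊆S s∈T) y∈qx y∈rs
        where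
        y≢q : y ≢ q
        y≢q refl = independent⇒∉cl-pair T-ind q∈T r∈T s∈T q≢r q≢s y∈rs

      SmallerSpan : Set
      SmallerSpan = ∃[ T' ] (∣ T' ∣ < ∣ T ∣ × T' ⊆ S × _∈cl_ G x T')

      meeting-lines⇒smaller-span : ∀ {a b c d y} → a ∈ T → b ∈ T → c ∈ T → d ∈ T →
        a ≢ b → c ≢ d → a ≢ c → a ≢ d → b ≢ c → b ≢ d →
        _∈cl_ G y (⁅ a ⁆ ∪ ⁅ b ⁆) → _∈cl_ G y (⁅ c ⁆ ∪ ⁅ d ⁆) → _∈cl_ G x T → SmallerSpan
      meeting-lines⇒smaller-span {a} {b} {c} {d} {y}
        a∈T b∈T c∈T d∈T a≢b c≢d a≢c a≢d b≢c b≢d y∈ab y∈cd x∈clT =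
        (T - a - c) ∪ ⁅ y ⁆ , ∣T'∣<∣T∣ , T'⊆S ,
        meeting-lines-span simple y≢b y≢d (∈T-a-c b∈T (≢-sym a≢b) b≢c)
          (∈T-a-c d∈T (≢-sym a≢d) (≢-sym c≢d)) y∈ab y∈cd x∈clT
        where
        ∈T-a-c : ∀ {z} → z ∈ T → z ≢ a → z ≢ c → z ∈ T - a - c
        ∈T-a-c z∈T z≢a z≢c = x∈p∧x≢y⇒x∈p-y (x∈p∧x≢y⇒x∈p-y z∈T z≢a) z≢c
        y≢b : y ≢ b
        y≢b refl = independent⇒∉cl-pair T-ind b∈T c∈T d∈T b≢c b≢d y∈cd
        y≢d : y ≢ d
        y≢d refl = independent⇒∉cl-pair T-ind d∈T a∈T b∈T (≢-sym a≢d) (≢-sym b≢d) y∈ab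
        T'⊆S : (T - a - c) ∪ ⁅ y ⁆ ⊆ S
        T'⊆S = ∪-lub (T⊆S ∘ p-x⊆p ∘ p-x⊆p)
                     (x∈p⇒⁅x⁆⊆p (S-lc a b (T⊆S a∈T) (T⊆S b∈T) y y∈ab))
        ∣T'∣<∣T∣ : ∣ (T - a - c) ∪ ⁅ y ⁆ ∣ < ∣ T ∣
        ∣T'∣<∣T∣ = begin-strict
          ∣ (T - a - c) ∪ ⁅ y ⁆ ∣ ≤⟨ ∣p∪⁅x⁆∣≤1+∣p∣ (T - a - c) y ⟩
          suc ∣ T - a - c ∣       ≤⟨ x∈p⇒∣p-x∣<∣p∣ (x∈p∧x≢y⇒x∈p-y c∈T (≢-sym a≢c)) ⟩
          ∣ T - a ∣               <⟨ x∈p⇒∣p-x∣<∣p∣ a∈T ⟩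
          ∣ T ∣                   ∎
          where open ≤-Reasoning

      private
        ∈T : ∀ {z} → z ∈ T ∪ ⁅ x ⁆ → z ≢ x → z ∈ T
        ∈T = x∈p∪⁅y⁆∧x≢y⇒x∈p

      meeting-lines⇒∈-or-smaller-span : _∈cl_ G x T → MeetingLines (T ∪ ⁅ x ⁆) → x ∈ S ⊎ SmallerSpan
      meeting-lines⇒∈-or-smaller-span x∈clT
        (a , b , c , d , a∈C , b∈C , c∈C , d∈C , a≢b , c≢d , a≢c , a≢d , b≢c , b≢d , y , y∈ab , y∈cd)
        with a ≟ x | b ≟ x | c ≟ x | d ≟ x
      ... | yes refl | _ | _ | _ =
        inj₁ (meeting-line-through-x (∈T b∈C (≢-sym a≢b)) (∈T c∈C (≢-sym a≢c)) (∈T d∈C (≢-sym a≢d))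
                b≢c b≢d (subst (_∈cl_ G y) (∪-comm ⁅ a ⁆ ⁅ b ⁆) y∈ab) y∈cd)
      ... | no a≢x | yes refl | _ | _ =
        inj₁ (meeting-line-through-x (∈T a∈C a≢x) (∈T c∈C (≢-sym b≢c)) (∈T d∈C (≢-sym b≢d))
                a≢c a≢d y∈ab y∈cd)
      ... | no a≢x | no b≢x | yes refl | _ =
        inj₁ (meeting-line-through-x (∈T d∈C (≢-sym c≢d)) (∈T a∈C a≢x) (∈T b∈C b≢x)
                (≢-sym a≢d) (≢-sym b≢d) (subst (_∈cl_ G y) (∪-comm ⁅ c ⁆ ⁅ d ⁆) y∈cd) y∈ab)
      ... | no a≢x | no b≢x | no c≢x | yes refl =
        inj₁ (meeting-line-through-x (∈T c∈C c≢x) (∈T a∈C a≢x) (∈T b∈C b≢x)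
                (≢-sym a≢c) (≢-sym b≢c) y∈cd y∈ab)
      ... | no a≢x | no b≢x | no c≢x | no d≢x =
        inj₂ (meeting-lines⇒smaller-span (∈T a∈C a≢x) (∈T b∈C b≢x) (∈T c∈C c≢x) (∈T d∈C d≢x)
                a≢b c≢d a≢c a≢d b≢c b≢d y∈ab y∈cd x∈clT)

    ∈cl-⊆⇒∈ : (∀ C → Circuit G C → 4 ≤ ∣ C ∣ → MeetingLines C) →
              ∀ {x} T → Acc _<_ ∣ T ∣ → T ⊆ S → _∈cl_ G x T → x ∈ S
    ∈cl-⊆⇒∈ meet {x} T (acc rec) T⊆S x∈clT
      with ∣ T ∣ ≤? 2 | x ∈? T | any? (λ t → t ∈? T ×-dec x ∈cl? (T - t))
    ... | yes ∣T∣≤2 | _       | _ = small-set-closure T⊆S ∣T∣≤2 x∈clT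
    ... | no  _     | yes x∈T | _ = T⊆S x∈T
    ... | no  _     | no  _   | yes (t , t∈T , x∈clT-t) =
      ∈cl-⊆⇒∈ meet (T - t) (rec (x∈p⇒∣p-x∣<∣p∣ t∈T)) (T⊆S ∘ p-x⊆p) x∈clT-t
    ... | no  ∣T∣≰2 | no  x∉T | no  not-minimal
      with meeting-lines⇒∈-or-smaller-span T⊆S (minimal-span⇒independent x∈clT minimal) x∈clT
             (meet (T ∪ ⁅ x ⁆) (minimal-span⇒circuit x∉T x∈clT minimal) 4≤∣T∪x∣)
      where
      minimal : ∀ t → t ∈ T → ¬ _∈cl_ G x (T - t)
      minimal t t∈T x∈clT-t = not-minimal (t , t∈T , x∈clT-t)
      4≤∣T∪x∣ : 4 ≤ ∣ T ∪ ⁅ x ⁆ ∣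
      4≤∣T∪x∣ = subst (4 ≤_) (sym (x∉p⇒∣p∪⁅x⁆∣≡1+∣p∣ T x x∉T)) (s≤s (≰⇒> ∣T∣≰2))
    ... | inj₁ x∈S = x∈S
    ... | inj₂ (T' , ∣T'∣<∣T∣ , T'⊆S , x∈clT') = ∈cl-⊆⇒∈ meet T' (rec ∣T'∣<∣T∣) T'⊆S x∈clT'

corollary2p20 : ∀ (n : ℕ) (G : Matroid n) → NoLoops G → NoMultiplePoints G
    → (∀ S → Circuit G S → 4 ≤ ∣ S ∣
         → ∃[ a ] ∃[ b ] ∃[ c ] ∃[ d ]
             (a ∈ S × b ∈ S × c ∈ S × d ∈ S
              × a ≢ b × c ≢ d × a ≢ c × a ≢ d × b ≢ c × b ≢ d
              × ∃[ x ] (_∈cl_ G x (⁅ a ⁆ ∪ ⁅ b ⁆) × _∈cl_ G x (⁅ c ⁆ ∪ ⁅ d ⁆))))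
    → LineClosed G
corollary2p20 n G loopless simple meet S S-lc x x∈clS =
  ∈cl-⊆⇒∈ G loopless simple S S-lc meet S (<-wellFounded ∣ S ∣) ⊆-refl x∈clS
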